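{- The boolean function $f:B^5\to B$ given by $f(x_0,x_1,x_2,x_3,x_4)=S_{2,3}(x_1,x_2,x_3,x_4)+x_0x_1x_2x_3x_4$ is inconvenient.
   Context: $B=\{0,1\}$; $+$ is OR and juxtaposition is AND. $S_{2,3}(x_1,x_2,x_3,x_4)=1$ iff exactly two or exactly three of $x_1,\ldots,x_4$ equal $1$. A transient is a nonempty word $\mathbf{t}=t_1\cdots t_m$ over $B$ with consecutive letters different; $\Delta(\mathbf{t})=m-1$; the contraction of a nonempty binary word deletes every letter equal to its predecessor. A transient vector $\mathbf{x}=(\mathbf{x}_1,\ldots,\mathbf{x}_n)$ has $\Delta(\mathbf{x})=\sum_i\Delta(\mathbf{x}_i)$; it is proper if every $\Delta(\mathbf{x}_i)\ge1$. For proper $\mathbf{t}=t_1\cdots t_m$, $\tilde{\mathbf{t}}=t_1t_2$ if $m$ even and $t_1t_2t_3$ if $m$ odd; $\tilde{\mathbf{x}}$ is taken componentwise. Extension: for $f:B^n\to B$, $D_f(\mathbf{x})$ has as vertices the vectors of nonempty prefixes of the components of $\mathbf{x}$, with arcs appending one letter to exactly one component, and vertex label $\lambda(\mathbf{v})=f(\omega(\mathbf{v}))$ ($\omega$ = vector of last letters). $\mathbf{f}(\mathbf{x})$ is the longest contraction of $\lambda(\mathbf{v}^1)\cdots\lambda(\mathbf{v}^r)$ over directed paths from the vector of first letters of $\mathbf{x}$ to $\mathbf{x}$. Cost: $c_f(\mathbf{x})=\Delta(\mathbf{x})-\Delta(\mathbf{f}(\mathbf{x}))$. A function that depends on all its variables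 is convenient if $c_f(\mathbf{x})=c_f(\tilde{\mathbf{x}})$ for every proper transient vector $\mathbf{x}$, and inconvenient otherwise. -}

module Defs where

open import Data.Bool using (Bool; true; false; _∨_; _∧_; not; if_then_else_)
open import Data.Nat using (ℕ; zero; suc; _+_; _∸_; _≤_)
open import Data.Integer using (ℤ; +_; _-_)
open import Data.Fin using (Fin; zero; suc)
open import Data.List using (List; []; _∷_; _++_; length; map; take)
open import Data.Product using (Σ; _×_; _,_; ∃)
open import Relation.Binary.PropositionalEquality using (_≡_; _≢_)

BVec : ℕ → Set
BVec n = Fin n → Bool

ones : Bool → ℕ
ones true  = 1
ones false = 0

S23 : Bool → Bool → Bool → Bool → Bool
S23 a b c d with ones a + ones b + ones c + ones d
... | 2 = true
... | 3 = true
... | _ = false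

fP3 : BVec 5 → Bool
fP3 x = S23 (x (suc zero)) (x (suc (suc zero))) (x (suc (suc (suc zero)))) (x (suc (suc (suc (suc zero)))))
        ∨ (x zero ∧ x (suc zero) ∧ x (suc (suc zero)) ∧ x (suc (suc (suc zero))) ∧ x (suc (suc (suc (suc zero)))))

_≟F_ : ∀ {n} → Fin n → Fin n → Bool
zero  ≟F zero  = true
zero  ≟F suc _ = false
suc _ ≟F zero  = false
suc i ≟F suc j = i ≟F j

flipAt : ∀ {n} → Fin n → BVec n → BVec n
flipAt i a j = if i ≟F j then not (a j) else a j

DependsOnAll : ∀ {n} → (BVec n → Bool) → Set
DependsOnAll {n} f = (i : Fin n) → Σ (BVec n) λ a → f a ≢ f (flipAt i a)

data Transient : List Bool → Set where
  single : (b : Bool) → Transient (b ∷ [])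
  cons   : (b c : Bool) (l : List Bool) → b ≢ c → Transient (c ∷ l) → Transient (b ∷ c ∷ l)

Δ : List Bool → ℕ
Δ t = length t ∸ 1

WVec : ℕ → Set
WVec n = Fin n → List Bool

sumFin : ∀ {n} → (Fin n → ℕ) → ℕ
sumFin {zero}  g = 0
sumFin {suc n} g = g zero + sumFin (λ i → g (suc i))

TransientVector : ∀ {n} → WVec n → Set
TransientVector x = ∀ i → Transient (x i)

ΔV : ∀ {n} → WVec n → ℕ
ΔV x = sumFin (λ i → Δ (x i))

Proper : ∀ {n} → WVec n → Set
Proper x = TransientVector x × (∀ i → 1 ≤ Δ (x i))

isEven : ℕ → Bool
isEven zero          = true
isEven (suc zero)    = false
isEven (suc (suc m)) = isEven m

tilde : List Bool → List Bool
tilde t = if isEven (length t) then take 2 t else take 3 t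

tildeV : ∀ {n} → WVec n → WVec n
tildeV x i = tilde (x i)

_==B_ : Bool → Bool → Bool
true  ==B true  = true
false ==B false = true
_     ==B _     = false

contractFrom : Bool → List Bool → List Bool
contractFrom p []      = []
contractFrom p (b ∷ l) = if b ==B p then contractFrom p l else b ∷ contractFrom b l

contract : List Bool → List Bool
contract []      = []
contract (a ∷ l) = a ∷ contractFrom a l

-- last letter (vertices of D_f(x) have nonempty components, default irrelevant)
lastB : List Bool → Bool
lastB []          = false
lastB (b ∷ [])    = b
lastB (_ ∷ c ∷ l) = lastB (c ∷ l)

ω : ∀ {n} → WVec n → BVec n
ω v i = lastB (v i)

label : ∀ {n} → (BVec n → Bool) → WVec n → Bool
label f v = f (ω v)

start : ∀ {n} → WVec n → WVec n
start x i = take 1 (x i)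

-- Walk x v vs : vs is the list of vertices of a directed path in D_f(x)
-- from v to x, each arc appending one letter to exactly one component.
data Walk {n : ℕ} (x : WVec n) : WVec n → List (WVec n) → Set where
  done : (v : WVec n) → (∀ i → v i ≡ x i) → Walk x v (v ∷ [])
  step : (v w : WVec n) (i : Fin n) (b : Bool) (ws : List (WVec n)) →
         w i ≡ v i ++ (b ∷ []) → (∀ j → j ≢ i → w j ≡ v j) →
         Walk x w ws → Walk x v (v ∷ ws)

pathContrLen : ∀ {n} → (BVec n → Bool) → List (WVec n) → ℕ
pathContrLen f vs = length (contract (map (label f) vs))

-- k is the length of the longest contraction over all paths, i.e. the length of f(x)
ExtLength : ∀ {n} → (BVec n → Bool) → WVec n → ℕ → Set
ExtLength f x k =
  (Σ (List _) λ vs → Walk x (start x) vs × pathContrLen f vs ≡ k)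
  × (∀ vs → Walk x (start x) vs → pathContrLen f vs ≤ k)

-- c : the cost c_f(x) = Δ(x) - Δ(f(x)), with Δ(f(x)) = k - 1
Cost : ∀ {n} → (BVec n → Bool) → WVec n → ℤ → Set
Cost f x c = ∃ λ k → ExtLength f x k × c ≡ (+ ΔV x) - (+ (k ∸ 1))

Inconvenient : ∀ {n} → (BVec n → Bool) → Set
Inconvenient {n} f = DependsOnAll f ×
  (Σ (WVec n) λ x → Proper x × Σ ℤ λ c → Σ ℤ λ c' →
     Cost f x c × Cost f (tildeV x) c' × c ≢ c')

-- Take x = (0101, 01, 01, 10, 10), so that x̃ = (01, 01, 01, 10, 10), Δ(x) = 7 and
-- Δ(x̃) = 5.  The variable x₀ only matters when x₁ = ⋯ = x₄ = 1, and a detour through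
-- that point, where x₀ can oscillate, gains no more label changes than alternating
-- S_{2,3} by interleaving the moves of x₁, …, x₄.  Hence f(x) and f(x̃) both have
-- length 5, and the costs are 3 and 1.  Maximality of 5 is checked by an exhaustive
-- search over the paths of D_f, whose soundness is maxChanges-bound.
module Submission where

open import Defs
open import Data.Bool using (Bool; true; false; if_then_else_)
import Data.Bool as Bool
open import Data.Nat using (ℕ; zero; suc; _+_; _≤_; _⊔_; z≤n; s≤s; s≤s⁻¹)
open import Data.Nat.Properties
  using (≤-refl; m≤m⊔n; m≤n⇒m≤o⊔n; +-suc; +-monoʳ-≤; n≤0⇒n≡0; module ≤-Reasoning)
open import Data.Fin using (Fin; zero; suc; _≟_)
open import Data.Fin.Properties using (all?)
open import Data.List using (List; []; _∷_; _++_; length; map; drop)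
open import Data.List.Properties using (++-cancelˡ; ++-assoc; ++-identityʳ; take++drop≡id; ≡-dec)
open import Data.Product using (Σ; _×_; _,_)
open import Data.Empty using (⊥-elim)
open import Function.Definitions using (Congruent)
open import Relation.Nullary using (Dec; yes; no)
open import Relation.Nullary.Decidable using (from-yes)
open import Relation.Binary.PropositionalEquality

≟F-refl : ∀ {n} (i : Fin n) → (i ≟F i) ≡ true
≟F-refl zero    = refl
≟F-refl (suc i) = ≟F-refl i

≟F-≢ : ∀ {n} (i j : Fin n) → j ≢ i → (i ≟F j) ≡ false
≟F-≢ zero    zero    j≢i = ⊥-elim (j≢i refl)
≟F-≢ zero    (suc j) _   = refl
≟F-≢ (suc i) zero    _   = refl
≟F-≢ (suc i) (suc j) j≢i = ≟F-≢ i j (λ j≡i → j≢i (cong suc j≡i))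

_≗?_ : ∀ {n} (v w : WVec n) → Dec (v ≗ w)
v ≗? w = all? λ i → ≡-dec Bool._≟_ (v i) (w i)

update : ∀ {n} → WVec n → Fin n → List Bool → WVec n
update S i t j = if i ≟F j then t else S j

append : ∀ {n} → WVec n → Fin n → Bool → WVec n
append v i b = update v i (v i ++ b ∷ [])

update-≡ : ∀ {n} (S : WVec n) i t → update S i t i ≡ t
update-≡ S i t rewrite ≟F-refl i = refl

update-≢ : ∀ {n} (S : WVec n) i t j → j ≢ i → update S i t j ≡ S j
update-≢ S i t j j≢i rewrite ≟F-≢ i j j≢i = refl

≗-update : ∀ {n} {v w : WVec n} {i t} →
           w i ≡ t → (∀ j → j ≢ i → w j ≡ v j) → w ≗ update v i t
≗-update {i = i} wi≡t others j with j ≟ i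
... | yes refl rewrite ≟F-refl i = wi≡t
... | no  j≢i  rewrite ≟F-≢ i j j≢i = others j j≢i

append-cong : ∀ {n} {v w : WVec n} i b → v ≗ w → append v i b ≗ append w i b
append-cong i b v≗w j with i ≟F j
... | true  = cong (_++ b ∷ []) (v≗w i)
... | false = v≗w j

sumLen : ∀ {n} → WVec n → ℕ
sumLen S = sumFin (λ j → length (S j))

sumLen-update : ∀ {n} (S : WVec n) i b t → S i ≡ b ∷ t → sumLen S ≡ suc (sumLen (update S i t))
sumLen-update S zero    b t Si≡bt rewrite Si≡bt = refl
sumLen-update S (suc i) b t Si≡bt = trans
  (cong (length (S zero) +_) (sumLen-update (λ j → S (suc j)) i b t Si≡bt))
  (+-suc (length (S zero)) _)

maxFin : ∀ {n} → (Fin n → ℕ) → ℕ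
maxFin {zero}  g = 0
maxFin {suc n} g = g zero ⊔ maxFin (λ i → g (suc i))

≤-maxFin : ∀ {n} (g : Fin n → ℕ) i → g i ≤ maxFin g
≤-maxFin g zero    = m≤m⊔n _ _
≤-maxFin g (suc i) = m≤n⇒m≤o⊔n (g zero) (≤-maxFin (λ j → g (suc j)) i)

maxFin-cong : ∀ {n} {g h : Fin n → ℕ} → g ≗ h → maxFin g ≡ maxFin h
maxFin-cong {zero}  g≗h = refl
maxFin-cong {suc n} g≗h = cong₂ _⊔_ (g≗h zero) (maxFin-cong (λ i → g≗h (suc i)))

change : Bool → Bool → ℕ
change a b = if b ==B a then 0 else 1

length-contractFrom-∷ : ∀ a b l →
  length (contractFrom a (b ∷ l)) ≡ change a b + length (contractFrom b l)
length-contractFrom-∷ false false l = refl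
length-contractFrom-∷ false true  l = refl
length-contractFrom-∷ true  false l = refl
length-contractFrom-∷ true  true  l = refl

label-cong : ∀ {n} {f : BVec n → Bool} → Congruent _≗_ _≡_ f → Congruent _≗_ _≡_ (label f)
label-cong f-cong v≗w = f-cong (λ i → cong lastB (v≗w i))

run : ∀ {n} → WVec n → List (Fin n × Bool) → List (WVec n)
run v []             = v ∷ []
run v ((i , b) ∷ ms) = v ∷ run (append v i b) ms

final : ∀ {n} → WVec n → List (Fin n × Bool) → WVec n
final v []             = v
final v ((i , b) ∷ ms) = final (append v i b) ms

run-walk : ∀ {n} (x v : WVec n) ms → final v ms ≗ x → Walk x v (run v ms)
run-walk x v []             reaches = done v reaches
run-walk x v ((i , b) ∷ ms) reaches =
  step v (append v i b) i b _ (update-≡ v i _) (update-≢ v i _) (run-walk x (append v i b) ms reaches)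

rest : ∀ {n} → WVec n → WVec n
rest x i = drop 1 (x i)

module _ {n} (f : BVec n → Bool) where

  -- The most label changes along a path from v that appends the words S componentwise;
  -- the fuel N is sufficient once N ≥ sumLen S.
  mutual
    maxChanges : ℕ → WVec n → WVec n → ℕ
    maxChanges zero    v S = 0
    maxChanges (suc N) v S = maxFin (λ i → maxChangesVia N v S i (S i))

    maxChangesVia : ℕ → WVec n → WVec n → Fin n → List Bool → ℕ
    maxChangesVia N v S i []      = 0
    maxChangesVia N v S i (b ∷ t) =
      change (label f v) (label f (append v i b)) + maxChanges N (append v i b) (update S i t)

  maxChanges-cong : Congruent _≗_ _≡_ f → ∀ N {v w} S → v ≗ w → maxChanges N v S ≡ maxChanges N w S
  maxChanges-cong f-cong zero    S v≗w = refl
  maxChanges-cong f-cong (suc N) S v≗w = maxFin-cong (λ i → via i (S i))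
    where
    via : ∀ i l → maxChangesVia N _ S i l ≡ maxChangesVia N _ S i l
    via i []      = refl
    via i (b ∷ t) = cong₂ _+_
      (cong₂ change (label-cong f-cong v≗w) (label-cong f-cong (append-cong i b v≗w)))
      (maxChanges-cong f-cong N _ (append-cong i b v≗w))

  module _ (x : WVec n) where

    walk-prefix : ∀ {w ws} → Walk x w ws → ∀ i → Σ (List Bool) λ t → w i ++ t ≡ x i
    walk-prefix (done w w≗x) i = [] , trans (++-identityʳ (w i)) (w≗x i)
    walk-prefix (step v w i b ws wi others tl) j with j ≟ i
    ... | yes refl = let (t , wt≡x) = walk-prefix tl i in
      b ∷ t , trans (sym (++-assoc (v i) (b ∷ []) t)) (trans (cong (_++ t) (sym wi)) wt≡x)
    ... | no  j≢i  = let (t , wt≡x) = walk-prefix tl j in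
      t , trans (cong (_++ t) (sym (others j j≢i))) wt≡x

    pathContrLen-step : ∀ v {w ws} → Walk x w ws →
      pathContrLen f (v ∷ ws) ≡ change (label f v) (label f w) + pathContrLen f ws
    pathContrLen-step v (done w _) =
      trans (cong suc (length-contractFrom-∷ (label f v) (label f w) [])) (sym (+-suc _ _))
    pathContrLen-step v (step w _ _ _ ws _ _ _) =
      trans (cong suc (length-contractFrom-∷ (label f v) (label f w) (map (label f) ws))) (sym (+-suc _ _))

    remaining-step : ∀ {v w : WVec n} {ws i b} (S : WVec n) → (∀ j → v j ++ S j ≡ x j) →
      w i ≡ v i ++ b ∷ [] → (∀ j → j ≢ i → w j ≡ v j) → Walk x w ws →
      Σ (List Bool) λ t → S i ≡ b ∷ t × (∀ j → w j ++ update S i t j ≡ x j)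
    remaining-step {v} {w} {i = i} {b} S vS≡x wi others tl =
      t , Si≡bt , wS′≡x
      where
      t : List Bool
      t = let (t , _) = walk-prefix tl i in t
      vbt≡x : v i ++ b ∷ t ≡ x i
      vbt≡x = let (_ , wt≡x) = walk-prefix tl i in
        trans (sym (++-assoc (v i) (b ∷ []) t)) (trans (cong (_++ t) (sym wi)) wt≡x)
      Si≡bt : S i ≡ b ∷ t
      Si≡bt = ++-cancelˡ (v i) _ _ (trans (vS≡x i) (sym vbt≡x))
      wS′≡x : ∀ j → w j ++ update S i t j ≡ x j
      wS′≡x j with j ≟ i
      ... | yes refl rewrite update-≡ S i t =
        trans (cong (_++ t) wi) (trans (++-assoc (v i) (b ∷ []) t) vbt≡x)
      ... | no  j≢i  rewrite update-≢ S i t j j≢i =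
        trans (cong (_++ S j) (others j j≢i)) (vS≡x j)

    maxChanges-bound : Congruent _≗_ _≡_ f → ∀ N {v vs} → Walk x v vs → (S : WVec n) →
      (∀ i → v i ++ S i ≡ x i) → sumLen S ≤ N → pathContrLen f vs ≤ suc (maxChanges N v S)
    maxChanges-bound f-cong N (done v _) S vS≡x S≤N = s≤s z≤n
    maxChanges-bound f-cong N {v} (step v w i b ws wi others tl) S vS≡x S≤N
      with remaining-step {v = v} {w = w} S vS≡x wi others tl | N
    ... | t , Si≡bt , _ | zero with () ← trans (sym (sumLen-update S i b t Si≡bt)) (n≤0⇒n≡0 S≤N)
    ... | t , Si≡bt , wS′≡x | suc N′ = begin
      pathContrLen f (v ∷ ws)                                ≡⟨ pathContrLen-step v tl ⟩
      change (label f v) (label f w) + pathContrLen f ws     ≤⟨ +-monoʳ-≤ _ ih ⟩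
      change (label f v) (label f w) + suc (maxChanges N′ w S′)
        ≡⟨ +-suc _ _ ⟩
      suc (change (label f v) (label f w) + maxChanges N′ w S′)
        ≡⟨ cong suc (cong₂ _+_ (cong (change (label f v)) (label-cong f-cong w≗vb))
                               (maxChanges-cong f-cong N′ S′ w≗vb)) ⟩
      suc (maxChangesVia N′ v S i (b ∷ t))                   ≡⟨ cong (λ l → suc (maxChangesVia N′ v S i l)) Si≡bt ⟨
      suc (maxChangesVia N′ v S i (S i))                     ≤⟨ s≤s (≤-maxFin (λ j → maxChangesVia N′ v S j (S j)) i) ⟩
      suc (maxChanges (suc N′) v S)                          ∎
      where
      open ≤-Reasoning
      S′ : WVec n
      S′ = update S i t
      w≗vb : w ≗ append v i b
      w≗vb = ≗-update wi others
      ih : pathContrLen f ws ≤ suc (maxChanges N′ w S′)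
      ih = maxChanges-bound f-cong N′ tl S′ wS′≡x
             (s≤s⁻¹ (subst (_≤ suc N′) (sumLen-update S i b t Si≡bt) S≤N))

  longestBound : WVec n → ℕ
  longestBound x = suc (maxChanges (sumLen (rest x)) (start x) (rest x))

  extLength-attained : Congruent _≗_ _≡_ f → ∀ x ms → final (start x) ms ≗ x →
    pathContrLen f (run (start x) ms) ≡ longestBound x → ExtLength f x (longestBound x)
  extLength-attained f-cong x ms reaches attains =
    (run (start x) ms , run-walk x (start x) ms reaches , attains) ,
    λ vs walk → maxChanges-bound x f-cong _ walk (rest x) (λ i → take++drop≡id 1 (x i)) ≤-refl

pattern 𝟘 = false
pattern 𝟙 = true

x₀ : WVec 5
x₀ zero                         = 𝟘 ∷ 𝟙 ∷ 𝟘 ∷ 𝟙 ∷ []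
x₀ (suc zero)                   = 𝟘 ∷ 𝟙 ∷ []
x₀ (suc (suc zero))             = 𝟘 ∷ 𝟙 ∷ []
x₀ (suc (suc (suc zero)))       = 𝟙 ∷ 𝟘 ∷ []
x₀ (suc (suc (suc (suc zero)))) = 𝟙 ∷ 𝟘 ∷ []

alternating : ∀ b l → Transient (b ∷ l) → Transient (Bool.not b ∷ b ∷ l)
alternating 𝟘 l tr = cons 𝟙 𝟘 l (λ ()) tr
alternating 𝟙 l tr = cons 𝟘 𝟙 l (λ ()) tr

x₀-proper : Proper x₀
x₀-proper = transient , nonconstant
  where
  transient : TransientVector x₀
  transient zero                         = alternating 𝟙 _ (alternating 𝟘 _ (alternating 𝟙 _ (single 𝟙)))
  transient (suc zero)                   = alternating 𝟙 _ (single 𝟙)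
  transient (suc (suc zero))             = alternating 𝟙 _ (single 𝟙)
  transient (suc (suc (suc zero)))       = alternating 𝟘 _ (single 𝟘)
  transient (suc (suc (suc (suc zero)))) = alternating 𝟘 _ (single 𝟘)
  nonconstant : ∀ i → 1 ≤ Δ (x₀ i)
  nonconstant zero                         = s≤s z≤n
  nonconstant (suc zero)                   = s≤s z≤n
  nonconstant (suc (suc zero))             = s≤s z≤n
  nonconstant (suc (suc (suc zero)))       = s≤s z≤n
  nonconstant (suc (suc (suc (suc zero)))) = s≤s z≤n

i₀ i₁ i₂ i₃ i₄ : Fin 5
i₀ = zero
i₁ = suc zero
i₂ = suc (suc zero)
i₃ = suc (suc (suc zero))
i₄ = suc (suc (suc (suc zero)))

-- Both label words contract to 1 0 1 0 1; the oscillation of x₀ in the first is wasted.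
x₀-path : List (Fin 5 × Bool)
x₀-path = (i₀ , 𝟙) ∷ (i₀ , 𝟘) ∷ (i₀ , 𝟙) ∷ (i₃ , 𝟘) ∷ (i₁ , 𝟙) ∷ (i₄ , 𝟘) ∷ (i₂ , 𝟙) ∷ []

x̃₀-path : List (Fin 5 × Bool)
x̃₀-path = (i₀ , 𝟙) ∷ (i₃ , 𝟘) ∷ (i₁ , 𝟙) ∷ (i₄ , 𝟘) ∷ (i₂ , 𝟙) ∷ []

bvec : Bool → Bool → Bool → Bool → Bool → BVec 5
bvec a b c d e zero                         = a
bvec a b c d e (suc zero)                   = b
bvec a b c d e (suc (suc zero))             = c
bvec a b c d e (suc (suc (suc zero)))       = d
bvec a b c d e (suc (suc (suc (suc zero)))) = e

fP3-dependsOnAll : DependsOnAll fP3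
fP3-dependsOnAll zero                         = bvec 𝟘 𝟙 𝟙 𝟙 𝟙 , λ ()
fP3-dependsOnAll (suc zero)                   = bvec 𝟘 𝟘 𝟙 𝟘 𝟘 , λ ()
fP3-dependsOnAll (suc (suc zero))             = bvec 𝟘 𝟙 𝟘 𝟘 𝟘 , λ ()
fP3-dependsOnAll (suc (suc (suc zero)))       = bvec 𝟘 𝟙 𝟘 𝟘 𝟘 , λ ()
fP3-dependsOnAll (suc (suc (suc (suc zero)))) = bvec 𝟘 𝟙 𝟘 𝟘 𝟘 , λ ()

fP3-cong : Congruent _≗_ _≡_ fP3
fP3-cong a≗b rewrite a≗b i₀ | a≗b i₁ | a≗b i₂ | a≗b i₃ | a≗b i₄ = refl

proposition3 : Inconvenient fP3
proposition3 = fP3-dependsOnAll , x₀ , x₀-proper , _ , _ , (_ , f[x₀] , refl) , (_ , f[x̃₀] , refl) , λ ()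
  where
  f[x₀] : ExtLength fP3 x₀ 5
  f[x₀] = extLength-attained fP3 fP3-cong x₀ x₀-path (from-yes (final (start x₀) x₀-path ≗? x₀)) refl
  f[x̃₀] : ExtLength fP3 (tildeV x₀) 5
  f[x̃₀] = extLength-attained fP3 fP3-cong (tildeV x₀) x̃₀-path (from-yes (final (start (tildeV x₀)) x̃₀-path ≗? tildeV x₀)) refl
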